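{- Let $(\mathscr{A},\preccurlyeq,\to)$ be an implicative structure. For all separators $S\subseteq\mathscr{A}$, the following assertions are equivalent: (1) ${\pitchfork}^{\mathscr{A}}\in S$; (2) $[a\wedge b]_{/S}=[a\times b]_{/S}$ for all $a,b\in\mathscr{A}$; (3) $S$ is a filter (w.r.t. the ordering $\preccurlyeq$).
   Context: An implicative structure is a complete lattice $(\mathscr{A},\preccurlyeq)$ (meets $\bigwedge$, binary meet $\wedge$) with $\to$ anti-monotonic in its first and monotonic in its second argument, commuting with arbitrary meets in its second argument. Closed $\lambda$-terms with parameters in $\mathscr{A}$ are interpreted via application $ab=\bigwedge\{c:a\preccurlyeq(b\to c)\}$ and abstraction $\bigwedge_a(a\to f(a))$. A separator is an upwards closed $S\subseteq\mathscr{A}$ containing $(\lambda xy.x)^{\mathscr{A}}=\bigwedge_{a,b}(a\to b\to a)$ and $(\lambda xyz.xz(yz))^{\mathscr{A}}$ and closed under modus ponens. ${\pitchfork}^{\mathscr{A}}=(\lambda xy.x)^{\mathscr{A}}\wedge(\lambda xy.y)^{\mathscr{A}}=\bigwedge_{a,b}(a\to b\to a\wedge b)$. Conjunction is $a\times b=\bigwedge_{c\in\mathscr{A}}((a\to b\to c)\to c)$. $[a]_{/S}$ is the class of $a$ in the poset reflection $\mathscr{A}/S$ of the preorder $a\vdash_S b$ iff $(a\to b)\in S$. -}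

module Defs where

open import Data.Product using (Σ; ∃; ∃-syntax; _×_; _,_)
open import Data.Sum using (_⊎_)
open import Data.Empty using (⊥)
open import Relation.Binary.PropositionalEquality using (_≡_)
open import Relation.Binary.Structures using (IsPartialOrder)

record ImplicativeStructure : Set₁ where
  infixr 5 _⇒_
  infix 4 _≼_
  field
    Carrier   : Set
    _≼_       : Carrier → Carrier → Set
    isPartialOrder : IsPartialOrder _≡_ _≼_
    ⋀         : (Carrier → Set) → Carrier
    ⋀-lower   : (X : Carrier → Set) (x : Carrier) → X x → ⋀ X ≼ x
    ⋀-greatest : (X : Carrier → Set) (c : Carrier) →
                 ((x : Carrier) → X x → c ≼ x) → c ≼ ⋀ X
    _⇒_       : Carrier → Carrier → Carrier
    ⇒-anti    : ∀ {a a′ b} → a′ ≼ a → (a ⇒ b) ≼ (a′ ⇒ b)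
    ⇒-mono    : ∀ {a b b′} → b ≼ b′ → (a ⇒ b) ≼ (a ⇒ b′)
    ⇒-⋀       : (a : Carrier) (B : Carrier → Set) →
                (a ⇒ ⋀ B) ≡ ⋀ (λ c → ∃[ b ] (B b × c ≡ (a ⇒ b)))

  _∧_ : Carrier → Carrier → Carrier
  a ∧ b = ⋀ (λ c → c ≡ a ⊎ c ≡ b)

  ⋀ᶠ : (Carrier → Carrier) → Carrier
  ⋀ᶠ f = ⋀ (λ c → ∃[ a ] (c ≡ f a))

  _·_ : Carrier → Carrier → Carrier
  a · b = ⋀ (λ c → a ≼ (b ⇒ c))

  K : Carrier
  K = ⋀ᶠ (λ a → ⋀ᶠ (λ b → a ⇒ b ⇒ a))

  -- (λxy.y)^A = ⋀_{a,b} (a → b → b)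
  K′ : Carrier
  K′ = ⋀ᶠ (λ a → ⋀ᶠ (λ b → a ⇒ b ⇒ b))

  S : Carrier
  S = ⋀ᶠ (λ a → ⋀ᶠ (λ b → ⋀ᶠ (λ c → a ⇒ b ⇒ c ⇒ ((a · c) · (b · c)))))

  ⋔ : Carrier
  ⋔ = K ∧ K′

  -- a × b = ⋀_c ((a → b → c) → c)
  _⊗_ : Carrier → Carrier → Carrier
  a ⊗ b = ⋀ᶠ (λ c → (a ⇒ b ⇒ c) ⇒ c)

  record IsSeparator (Sep : Carrier → Set) : Set where
    field
      upward : ∀ {a b} → Sep a → a ≼ b → Sep b
      K∈     : Sep K
      S∈     : Sep S
      mp     : ∀ {a b} → Sep (a ⇒ b) → Sep a → Sep b

  _⊢[_]_ : Carrier → (Carrier → Set) → Carrier → Set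
  a ⊢[ Sep ] b = Sep (a ⇒ b)

  -- equality of classes in the poset reflection A/S:
  -- [a]_S = [b]_S  iff  a ⊢_S b and b ⊢_S a
  EqClass : (Carrier → Set) → Carrier → Carrier → Set
  EqClass Sep a b = (a ⊢[ Sep ] b) × (b ⊢[ Sep ] a)

  ⊤ᴬ : Carrier
  ⊤ᴬ = ⋀ (λ _ → ⊥)

  record IsFilter (F : Carrier → Set) : Set where
    field
      top∈   : F ⊤ᴬ
      upward : ∀ {a b} → F a → a ≼ b → F b
      meet   : ∀ {a b} → F a → F b → F (a ∧ b)

module Submission where

-- Everything rests on the adjunction  a · b ≼ c  ⇔  a ≼ b ⇒ c  between
-- application and implication.  From it we get the β-inequalities of the
-- combinators K, K′ = λxy.y, S, and of the derived combinators
--   I = SKK,  flip w = λz. z w,  pair z w = λf. f z w,  diag = λz. pair z z,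
-- and, since separators are closed under application, all of them lie in S.
-- Two order-theoretic facts about ⋔ and ⊗ then carry the proof:
--   * ⋔ ≼ a ⇒ b ⇒ a ∧ b  (⋔ "is" the meet-former), and
--   * x ≼ a ⊗ b  as soon as  x · f ≼ (f · a) · b  for every f.
-- (1 ⇒ 2): diag realizes a ∧ b ⊢ a ⊗ b, and flip ⋔ realizes a ⊗ b ⊢ a ∧ b.
-- (2 ⇒ 1): K ⊗ K′ ∈ S (separators are closed under ⊗), hence K ∧ K′ ∈ S.
-- (1 ⇒ 3): ⋔ turns a ∈ S, b ∈ S into a ∧ b ∈ S.  (3 ⇒ 1): K, K′ ∈ S.

open import Defs
open import Data.Product using (_×_; _,_; proj₂)
open import Data.Sum using (inj₁; inj₂)
open import Function.Bundles using (_⇔_; mk⇔)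
open import Relation.Binary.PropositionalEquality using (refl; subst; sym)
open import Relation.Binary.Structures using (IsPartialOrder; IsPreorder)

module Theory (𝒜 : ImplicativeStructure) where
  open ImplicativeStructure 𝒜

  ≼-refl : ∀ {a} → a ≼ a
  ≼-refl = IsPreorder.refl (IsPartialOrder.isPreorder isPartialOrder)

  infixr 3 _∙_
  _∙_ : ∀ {a b c} → a ≼ b → b ≼ c → a ≼ c
  _∙_ = IsPreorder.trans (IsPartialOrder.isPreorder isPartialOrder)

  ⋀ᶠ-lower : ∀ f a → ⋀ᶠ f ≼ f a
  ⋀ᶠ-lower f a = ⋀-lower _ (f a) (a , refl)

  ⋀ᶠ-greatest : ∀ {c} f → (∀ a → c ≼ f a) → c ≼ ⋀ᶠ f
  ⋀ᶠ-greatest f h = ⋀-greatest _ _ λ { _ (a , refl) → h a }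

  ∧-lowerˡ : ∀ a b → (a ∧ b) ≼ a
  ∧-lowerˡ a b = ⋀-lower _ a (inj₁ refl)

  ∧-lowerʳ : ∀ a b → (a ∧ b) ≼ b
  ∧-lowerʳ a b = ⋀-lower _ b (inj₂ refl)

  ∧-greatest : ∀ {a b c} → c ≼ a → c ≼ b → c ≼ (a ∧ b)
  ∧-greatest p q = ⋀-greatest _ _ λ { _ (inj₁ refl) → p ; _ (inj₂ refl) → q }

  ≼-⊤ : ∀ a → a ≼ ⊤ᴬ
  ≼-⊤ a = ⋀-greatest _ a λ _ ()

  -- Application is left adjoint to implication: a · b ≼ c ⇔ a ≼ b ⇒ c.
  -- The unit  a ≼ b ⇒ a · b  is where ⇒ commuting with meets is used.

  ·-adjˡ : ∀ {a b c} → a ≼ (b ⇒ c) → (a · b) ≼ c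
  ·-adjˡ {c = c} p = ⋀-lower _ c p

  ·-unit : ∀ a b → a ≼ (b ⇒ (a · b))
  ·-unit a b = subst (a ≼_) (sym (⇒-⋀ b _))
    (⋀-greatest _ a λ { _ (c , a≼b⇒c , refl) → a≼b⇒c })

  ·-adjʳ : ∀ {a b c} → (a · b) ≼ c → a ≼ (b ⇒ c)
  ·-adjʳ {a} {b} p = ·-unit a b ∙ ⇒-mono p

  ·-mono : ∀ {a a′ b b′} → a ≼ a′ → b ≼ b′ → (a · b) ≼ (a′ · b′)
  ·-mono p q = ⋀-greatest _ _ λ c r → ⋀-lower _ c (p ∙ r ∙ ⇒-anti q)

  ·-monoˡ : ∀ {a a′ b} → a ≼ a′ → (a · b) ≼ (a′ · b)
  ·-monoˡ p = ·-mono p ≼-refl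

  eval : ∀ {a b} → ((a ⇒ b) · a) ≼ b
  eval = ·-adjˡ ≼-refl

  K-β : ∀ a b → ((K · a) · b) ≼ a
  K-β a b = ·-adjˡ (·-adjˡ (⋀ᶠ-lower _ a ∙ ⋀ᶠ-lower _ b))

  K′-β : ∀ a b → ((K′ · a) · b) ≼ b
  K′-β a b = ·-adjˡ (·-adjˡ (⋀ᶠ-lower _ a ∙ ⋀ᶠ-lower _ b))

  S-β : ∀ a b c → (((S · a) · b) · c) ≼ ((a · c) · (b · c))
  S-β a b c = ·-adjˡ (·-adjˡ (·-adjˡ
    (⋀ᶠ-lower _ a ∙ ⋀ᶠ-lower _ b ∙ ⋀ᶠ-lower _ c)))

  S-β′ : ∀ {x y z u v} → (x · z) ≼ u → (y · z) ≼ v →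
         (((S · x) · y) · z) ≼ (u · v)
  S-β′ {x} {y} {z} p q = S-β x y z ∙ ·-mono p q

  I : Carrier
  I = (S · K) · K

  I-β : ∀ z → (I · z) ≼ z
  I-β z = S-β K K z ∙ K-β z (K · z)

  KI≼K′ : (K · I) ≼ K′
  KI≼K′ = ⋀ᶠ-greatest _ λ a → ⋀ᶠ-greatest _ λ b →
    ·-adjʳ (K-β I a ∙ ·-adjʳ (I-β b))

  flip : Carrier → Carrier
  flip w = (S · I) · (K · w)

  flip-β : ∀ w z → (flip w · z) ≼ (z · w)
  flip-β w z = S-β′ (I-β z) (K-β w z)

  pair : Carrier → Carrier → Carrier
  pair z w = (S · flip z) · (K · w)

  pair-β : ∀ z w f → (pair z w · f) ≼ ((f · z) · w)
  pair-β z w f = S-β′ (flip-β z f) (K-β w f)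

  -- diag = λz. pair z z = S (S (K S) (S (K (S I)) K)) K
  diag : Carrier
  diag = (S · ((S · (K · S)) · ((S · (K · (S · I))) · K))) · K

  diag-β : ∀ z → (diag · z) ≼ pair z z
  diag-β z = S-β′ (S-β′ (K-β S z) (S-β′ (K-β (S · I) z) ≼-refl)) ≼-refl

  ⋔-β : ∀ a b → ((⋔ · a) · b) ≼ (a ∧ b)
  ⋔-β a b = ∧-greatest (·-monoˡ (·-monoˡ (∧-lowerˡ K K′)) ∙ K-β a b)
                       (·-monoˡ (·-monoˡ (∧-lowerʳ K K′)) ∙ K′-β a b)

  ⋔-meet : ∀ a b → ⋔ ≼ (a ⇒ b ⇒ (a ∧ b))
  ⋔-meet a b = ·-adjʳ (·-adjʳ (⋔-β a b))

  ⊗-intro : ∀ {x a b} → (∀ f → (x · f) ≼ ((f · a) · b)) → x ≼ (a ⊗ b)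
  ⊗-intro h = ⋀ᶠ-greatest _ λ c → ·-adjʳ (h _ ∙ ·-adjˡ eval)

  ⊗-elim : ∀ a b c → (a ⊗ b) ≼ ((a ⇒ b ⇒ c) ⇒ c)
  ⊗-elim a b c = ⋀ᶠ-lower _ c

  pair≼⊗ : ∀ a b → pair a b ≼ (a ⊗ b)
  pair≼⊗ a b = ⊗-intro (pair-β a b)

  diag-∧⊢⊗ : ∀ a b → diag ≼ ((a ∧ b) ⇒ (a ⊗ b))
  diag-∧⊢⊗ a b = ·-adjʳ (⊗-intro λ f →
    ·-monoˡ (diag-β (a ∧ b)) ∙ pair-β (a ∧ b) (a ∧ b) f
    ∙ ·-mono (·-mono ≼-refl (∧-lowerˡ a b)) (∧-lowerʳ a b))

  flip⋔-⊗⊢∧ : ∀ a b → flip ⋔ ≼ ((a ⊗ b) ⇒ (a ∧ b))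
  flip⋔-⊗⊢∧ a b = ·-adjʳ (flip-β ⋔ (a ⊗ b)
    ∙ ·-adjˡ (⊗-elim a b (a ∧ b) ∙ ⇒-anti (⋔-meet a b)))

  module InSeparator (Sep : Carrier → Set) (sep : IsSeparator Sep) where
    open IsSeparator sep

    ·-closed : ∀ {a b} → Sep a → Sep b → Sep (a · b)
    ·-closed {a} {b} p q = mp (upward p (·-unit a b)) q

    I∈ : Sep I
    I∈ = ·-closed (·-closed S∈ K∈) K∈

    K′∈ : Sep K′
    K′∈ = upward (·-closed K∈ I∈) KI≼K′

    flip∈ : ∀ {w} → Sep w → Sep (flip w)
    flip∈ w∈ = ·-closed (·-closed S∈ I∈) (·-closed K∈ w∈)

    diag∈ : Sep diag
    diag∈ = ·-closed (·-closed S∈ (·-closed (·-closed S∈ (·-closed K∈ S∈))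
              (·-closed (·-closed S∈ (·-closed K∈ (·-closed S∈ I∈))) K∈))) K∈

    ⊗-closed : ∀ {a b} → Sep a → Sep b → Sep (a ⊗ b)
    ⊗-closed {a} {b} a∈ b∈ =
      upward (·-closed (·-closed S∈ (flip∈ a∈)) (·-closed K∈ b∈)) (pair≼⊗ a b)

    ⋔⇒∧≡⊗ : Sep ⋔ → ∀ a b → EqClass Sep (a ∧ b) (a ⊗ b)
    ⋔⇒∧≡⊗ ⋔∈ a b = upward diag∈ (diag-∧⊢⊗ a b) , upward (flip∈ ⋔∈) (flip⋔-⊗⊢∧ a b)

    ∧≡⊗⇒⋔ : (∀ a b → EqClass Sep (a ∧ b) (a ⊗ b)) → Sep ⋔
    ∧≡⊗⇒⋔ h = mp (proj₂ (h K K′)) (⊗-closed K∈ K′∈)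

    ⋔⇒filter : Sep ⋔ → IsFilter Sep
    ⋔⇒filter ⋔∈ = record
      { top∈   = upward K∈ (≼-⊤ K)
      ; upward = upward
      ; meet   = λ {a} {b} a∈ b∈ → mp (mp (upward ⋔∈ (⋔-meet a b)) a∈) b∈
      }

    filter⇒⋔ : IsFilter Sep → Sep ⋔
    filter⇒⋔ F = IsFilter.meet F K∈ K′∈

proposition3p27 : (𝒜 : ImplicativeStructure) → let open ImplicativeStructure 𝒜 in
    (Sep : Carrier → Set) → IsSeparator Sep →
    (Sep ⋔ ⇔ (∀ a b → EqClass Sep (a ∧ b) (a ⊗ b)))
    × (Sep ⋔ ⇔ IsFilter Sep)
proposition3p27 𝒜 Sep sep =
  mk⇔ ⋔⇒∧≡⊗ ∧≡⊗⇒⋔ , mk⇔ ⋔⇒filter filter⇒⋔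
  where open Theory.InSeparator 𝒜 Sep sep
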